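{- Let $k$ be a positive integer and let $G$ and $H$ be graphs. If $G \equiv_{C_{2k}} H$, then $G^1 \equiv_{C_k} H^1$.
   Context: All graphs are finite and simple. For a positive integer $m$, $C_m$ denotes the $m$-variable fragment of first-order logic with counting quantifiers $\exists^{\geq n}$ over the signature of graphs (one binary edge relation); $G \equiv_{C_m} H$ means that $G$ and $H$ satisfy exactly the same sentences of $C_m$. For $s \in \mathbb{N}$, the $s$-subdivision $G^s$ of a graph $G$ is the graph obtained from $G$ by replacing every edge by a path of length $s+1$ (i.e., with $s$ new internal vertices); in particular $G^1$ is obtained by subdividing every edge once. -}

module Defs where

open import Data.Nat using (ℕ)
open import Data.Fin using (Fin; _≟_; _<_)
open import Data.Bool using (Bool; true; false; if_then_else_)
open import Data.Maybe using (Maybe; just; nothing)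
open import Data.Product using (Σ; _×_; _,_)
open import Data.Sum using (_⊎_; inj₁; inj₂)
open import Data.Empty using (⊥)
open import Relation.Nullary using (¬_; ⌊_⌋)
open import Relation.Binary.PropositionalEquality using (_≡_; _≢_)
open import Function.Definitions using (Injective)

record Graph (n : ℕ) : Set where
  field
    adj    : Fin n → Fin n → Bool
    sym    : ∀ u v → adj u v ≡ adj v u
    irrefl : ∀ v → adj v v ≡ false

record Structure : Set₁ where
  field
    V : Set
    E : V → V → Set

toStr : ∀ {n} → Graph n → Structure
toStr {n} G = record { V = Fin n ; E = λ u v → Graph.adj G u v ≡ true }

-- 1-subdivision G^1: the original vertices plus one new vertex for every
-- edge {a,b} (represented as the pair (a,b) with a < b); the new vertex
-- is adjacent exactly to a and b.

SubV : ∀ {n} → Graph n → Set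
SubV {n} G = Fin n ⊎ Σ (Fin n × Fin n) (λ { (a , b) → a < b × Graph.adj G a b ≡ true })

SubE : ∀ {n} (G : Graph n) → SubV G → SubV G → Set
SubE G (inj₁ u) (inj₂ ((a , b) , _)) = u ≡ a ⊎ u ≡ b
SubE G (inj₂ ((a , b) , _)) (inj₁ u) = u ≡ a ⊎ u ≡ b
SubE G (inj₁ _) (inj₁ _) = ⊥
SubE G (inj₂ _) (inj₂ _) = ⊥

subdivide : ∀ {n} → Graph n → Structure
subdivide G = record { V = SubV G ; E = SubE G }

-- C_m : m-variable first-order logic with counting quantifiers ∃^{≥c}
-- (variables are Fin m)

data Formula (m : ℕ) : Set where
  edge    : Fin m → Fin m → Formula m
  equal   : Fin m → Fin m → Formula m
  neg     : Formula m → Formula m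
  conj    : Formula m → Formula m → Formula m
  exists≥ : ℕ → Fin m → Formula m → Formula m

Free : ∀ {m} → Fin m → Formula m → Set
Free i (edge a b)      = i ≡ a ⊎ i ≡ b
Free i (equal a b)     = i ≡ a ⊎ i ≡ b
Free i (neg φ)         = Free i φ
Free i (conj φ ψ)      = Free i φ ⊎ Free i ψ
Free i (exists≥ c x φ) = i ≢ x × Free i φ

Sentence : ∀ {m} → Formula m → Set
Sentence {m} φ = ∀ (i : Fin m) → ¬ Free i φ

-- partial assignments (unassigned variables make atoms false; irrelevant for sentences)
Assignment : ℕ → Set → Set
Assignment m V = Fin m → Maybe V

update : ∀ {m V} → Assignment m V → Fin m → V → Assignment m V
update ρ x v j = if ⌊ j ≟ x ⌋ then just v else ρ j

liftRel : ∀ {V : Set} → (V → V → Set) → Maybe V → Maybe V → Set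
liftRel R (just a) (just b) = R a b
liftRel R _ _ = ⊥

Sat : ∀ {m} (A : Structure) → Formula m → Assignment m (Structure.V A) → Set
Sat A (edge i j) ρ = liftRel (Structure.E A) (ρ i) (ρ j)
Sat A (equal i j) ρ = liftRel _≡_ (ρ i) (ρ j)
Sat A (neg φ) ρ = ¬ Sat A φ ρ
Sat A (conj φ ψ) ρ = Sat A φ ρ × Sat A ψ ρ
Sat A (exists≥ c x φ) ρ =
  Σ (Fin c → Structure.V A) λ f →
    Injective _≡_ _≡_ f × (∀ i → Sat A φ (update ρ x (f i)))

_⊨_ : ∀ {m} → Structure → Formula m → Set
A ⊨ φ = Sat A φ (λ _ → nothing)

C-equiv : (m : ℕ) → Structure → Structure → Set
C-equiv m A B = (φ : Formula m) → Sentence φ → ((A ⊨ φ → B ⊨ φ) × (B ⊨ φ → A ⊨ φ))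

{-# OPTIONS --safe #-}
module Submission where

-- A vertex of G¹ is encoded by an ordered pair of vertices of G: an original vertex v by (v , v),
-- the vertex subdividing the edge {a , b} by (a , b) and by (b , a).  Replacing every variable x of
-- a C_k formula by a pair (l x , r x) of variables gives a C_2k formula over G with the same meaning:
-- atoms become Boolean combinations of equalities and adjacencies between the pairs, and ∃^{≥c} x
-- becomes a count of representing pairs, in which loops (a , a) are counted twice so that every
-- vertex of G¹ is counted exactly twice, compared with 2c.  The number Σ_a #{b | ψ(a , b)} of ordered
-- pairs is at least N iff Σ_{t=1}^{N} #{a | ∃^{≥t} b ψ(a , b)} is, and the latter count needs no
-- variables besides l x and r x.  Finally, atoms with unassigned variables are replaced by false to
-- turn the translation into a sentence.

open import Defs
open import Axiom.UniquenessOfIdentityProofs using (module Decidable⇒UIP)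
open import Data.Bool as Bool using (true; false; if_then_else_)
open import Data.Empty using (⊥; ⊥-elim)
open import Data.Fin as Fin using (Fin; zero; suc; _↑ˡ_; _↑ʳ_)
import Data.Fin.Properties as Fin
open import Data.Fin.Subset using (Subset; ⁅_⁆; _∪_) renaming (_∈_ to _∈ₛ_; _∉_ to _∉ₛ_; ⊥ to ∅)
open import Data.Fin.Subset.Properties using (∉⊥; x∈⁅x⁆; x∈p∪q⁺; x∈p∪q⁻; x∈⁅y⁆⇒x≡y) renaming (_∈?_ to _∈ₛ?_)
open import Data.List using (List; []; _∷_; _++_; map; filter; length; lookup; allFin; tabulate; cartesianProduct)
import Data.List.Properties as List
open import Data.List.Membership.Propositional using (_∈_)
open import Data.List.Membership.Propositional.Properties
  using (∈-filter⁺; ∈-lookup; ∈-allFin; ∈-map⁺; ∈-map⁻; ∈-++⁺ˡ; ∈-++⁺ʳ; ∈-cartesianProduct⁺)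
import Data.List.Relation.Unary.All as All
open import Data.List.Relation.Unary.All.Properties using (all-filter)
import Data.List.Relation.Unary.Any as Any
open import Data.List.Relation.Unary.Any.Properties using (lookup-index)
open import Data.List.Relation.Unary.Unique.Propositional using (Unique; _∷_)
import Data.List.Relation.Unary.Unique.Propositional.Properties as Unique
open import Data.Maybe using (Maybe; just; nothing)
open import Data.Nat using (ℕ; zero; suc; _+_; _*_; _∸_; _≤_; _⊓_; z≤n)
open import Data.Nat.ListAction using () renaming (sum to listSum)
open import Data.Nat.ListAction.Properties using () renaming (sum-++ to listSum-++)
open import Data.Nat.Properties
open import Data.Product using (Σ; ∃; _×_; _,_; proj₁; proj₂)
open import Data.Product.Function.NonDependent.Propositional using (_×-⇔_)
open import Data.Sum using (_⊎_; inj₁; inj₂; swap)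
open import Data.Sum.Function.Propositional using (_⊎-⇔_)
open import Function using (_∘_; _⇔_; mk⇔; Equivalence)
open import Function.Definitions using (Injective)
open import Function.Properties.Equivalence using (⇔-setoid) renaming (refl to ⇔-refl; sym to ⇔-sym; trans to ⇔-trans)
open import Function.Related.TypeIsomorphisms using (¬-cong-⇔)
open import Level using (0ℓ)
open import Relation.Binary.Definitions using (tri<; tri≈; tri>)
open import Relation.Binary.PropositionalEquality
import Relation.Binary.Reasoning.Setoid as SetoidReasoning
open import Relation.Nullary using (Dec; yes; no; does; ¬_)
open import Relation.Nullary.Decidable using (dec-true; dec-false; does-⇔; ¬?; _×-dec_; _⊎-dec_; decidable-stable)
import Relation.Nullary.Decidable as Dec
open import Relation.Unary using (Decidable)
open import Algebra.Properties.CommutativeMonoid.Sum +-0-commutativeMonoid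
  using (sum-syntax; sum-cong-≗; ∑-distrib-+; ∑-comm; sum-replicate-zero)
open import Algebra.Properties.CommutativeSemigroup +-commutativeSemigroup using (interchange)

private
  variable
    A B : Set

module ⇔-Reasoning = SetoidReasoning (⇔-setoid 0ℓ)

-- Counting

≤-congʳ : ∀ {j m n} → m ≡ n → j ≤ m ⇔ j ≤ n
≤-congʳ refl = ⇔-refl

AtLeast : ℕ → (A → Set) → Set
AtLeast {A} c P = Σ (Fin c → A) λ f → Injective _≡_ _≡_ f × (∀ i → P (f i))

AtLeast-cong : {P Q : A → Set} → (∀ x → P x ⇔ Q x) → ∀ c → AtLeast c P ⇔ AtLeast c Q
AtLeast-cong P⇔Q c = mk⇔ (λ (f , f-inj , Pf) → f , f-inj , λ i → Equivalence.to (P⇔Q (f i)) (Pf i))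
                         (λ (f , f-inj , Qf) → f , f-inj , λ i → Equivalence.from (P⇔Q (f i)) (Qf i))

AtLeast-image : (g : A → B) → Injective _≡_ _≡_ g → {P : A → Set} {Q : B → Set} →
                (∀ x → P x ⇔ Q (g x)) → (∀ y → Q y → ∃ λ x → g x ≡ y) →
                ∀ c → AtLeast c P ⇔ AtLeast c Q
AtLeast-image g g-inj {P} {Q} P⇔Qg image c = mk⇔ to from
  where
  to : AtLeast c P → AtLeast c Q
  to (f , f-inj , Pf) = g ∘ f , f-inj ∘ g-inj , λ i → Equivalence.to (P⇔Qg (f i)) (Pf i)
  from : AtLeast c Q → AtLeast c P
  from (f , f-inj , Qf) = h , h-inj , λ i → Equivalence.from (P⇔Qg (h i)) (subst Q (sym (g∘h i)) (Qf i))
    where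
    h : Fin c → _
    h i = proj₁ (image (f i) (Qf i))
    g∘h : ∀ i → g (h i) ≡ f i
    g∘h i = proj₂ (image (f i) (Qf i))
    h-inj : Injective _≡_ _≡_ h
    h-inj {i} {j} eq = f-inj (trans (sym (g∘h i)) (trans (cong g eq) (g∘h j)))

indicator : {P : Set} → Dec P → ℕ
indicator P? = if does P? then 1 else 0

indicator-cong : {P Q : Set} → P ⇔ Q → (P? : Dec P) (Q? : Dec Q) → indicator P? ≡ indicator Q?
indicator-cong P⇔Q P? Q? = cong (λ b → if b then 1 else 0) (does-⇔ P⇔Q P? Q?)

indicator-yes : {P : Set} (P? : Dec P) → P → indicator P? ≡ 1
indicator-yes P? p = cong (λ b → if b then 1 else 0) (dec-true P? p)

indicator-no : {P : Set} (P? : Dec P) → ¬ P → indicator P? ≡ 0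
indicator-no P? ¬p = cong (λ b → if b then 1 else 0) (dec-false P? ¬p)

record Enumeration (A : Set) : Set where
  field
    elements : List A
    complete : ∀ x → x ∈ elements
    unique   : Unique elements
open Enumeration

count : Enumeration A → {P : A → Set} → Decidable P → ℕ
count e P? = listSum (map (indicator ∘ P?) (elements e))

length-filter : {P : A → Set} (P? : Decidable P) (xs : List A) →
                length (filter P? xs) ≡ listSum (map (indicator ∘ P?) xs)
length-filter P? [] = refl
length-filter P? (x ∷ xs) with does (P? x)
... | true  = cong suc (length-filter P? xs)
... | false = length-filter P? xs

lookup-injective : {xs : List A} → Unique xs → Injective _≡_ _≡_ (lookup xs)
lookup-injective (_ ∷ _)  {zero}  {zero}  _  = refl
lookup-injective (x≢ ∷ _) {zero}  {suc j} eq = ⊥-elim (All.lookup x≢ (∈-lookup j) eq)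
lookup-injective (x≢ ∷ _) {suc i} {zero}  eq = ⊥-elim (All.lookup x≢ (∈-lookup i) (sym eq))
lookup-injective (_ ∷ u)  {suc i} {suc j} eq = cong suc (lookup-injective u eq)

-- The witnesses are injected into, and picked from, the list of elements satisfying P.
atLeast⇔count : (e : Enumeration A) {P : A → Set} (P? : Decidable P) (c : ℕ) →
                AtLeast c P ⇔ c ≤ count e P?
atLeast⇔count e {P} P? c = ⇔-trans (mk⇔ to from) (≤-congʳ (length-filter P? (elements e)))
  where
  ys : List _
  ys = filter P? (elements e)

  to : AtLeast c P → c ≤ length ys
  to (f , f-inj , Pf) = Fin.injective⇒≤ position-injective
    where
    position : Fin c → Fin (length ys)
    position i = Any.index (∈-filter⁺ P? (complete e (f i)) (Pf i))
    position-injective : Injective _≡_ _≡_ position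
    position-injective {i} {j} eq = f-inj (begin
      f i                     ≡⟨ lookup-index (∈-filter⁺ P? (complete e (f i)) (Pf i)) ⟩
      lookup ys (position i)  ≡⟨ cong (lookup ys) eq ⟩
      lookup ys (position j)  ≡⟨ lookup-index (∈-filter⁺ P? (complete e (f j)) (Pf j)) ⟨
      f j                     ∎)
      where open ≡-Reasoning

  from : c ≤ length ys → AtLeast c P
  from c≤ = f , f-inj , λ i → All.lookup (all-filter P? (elements e)) (∈-lookup _)
    where
    f : Fin c → _
    f i = lookup ys (Fin.inject≤ i c≤)
    f-inj : Injective _≡_ _≡_ f
    f-inj eq = Fin.inject≤-injective c≤ c≤ _ _ (lookup-injective (Unique.filter⁺ P? (unique e)) eq)

Fin-enumeration : ∀ n → Enumeration (Fin n)
Fin-enumeration n = record { elements = allFin n ; complete = ∈-allFin ; unique = Unique.allFin⁺ n }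

_⊎-enumeration_ : Enumeration A → Enumeration B → Enumeration (A ⊎ B)
e ⊎-enumeration e′ = record
  { elements = map inj₁ (elements e) ++ map inj₂ (elements e′)
  ; complete = λ { (inj₁ x) → ∈-++⁺ˡ (∈-map⁺ inj₁ (complete e x))
                 ; (inj₂ y) → ∈-++⁺ʳ (map inj₁ (elements e)) (∈-map⁺ inj₂ (complete e′ y)) }
  ; unique   = Unique.++⁺ (Unique.map⁺ (λ { refl → refl }) (unique e))
                          (Unique.map⁺ (λ { refl → refl }) (unique e′))
                          disjoint
  }
  where
  disjoint : ∀ {w} → w ∈ map inj₁ (elements e) × w ∈ map inj₂ (elements e′) → ⊥
  disjoint (p , q) with ∈-map⁻ inj₁ p | ∈-map⁻ inj₂ q
  ... | _ , _ , refl | _ , _ , ()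

_×-enumeration_ : Enumeration A → Enumeration B → Enumeration (A × B)
e ×-enumeration e′ = record
  { elements = cartesianProduct (elements e) (elements e′)
  ; complete = λ (x , y) → ∈-cartesianProduct⁺ (complete e x) (complete e′ y)
  ; unique   = Unique.cartesianProduct⁺ (unique e) (unique e′)
  }

sum-map-++ : (f : A → ℕ) (xs ys : List A) →
             listSum (map f (xs ++ ys)) ≡ listSum (map f xs) + listSum (map f ys)
sum-map-++ f xs ys = trans (cong listSum (List.map-++ f xs ys)) (listSum-++ (map f xs) (map f ys))

sum-map-map : (f : B → ℕ) (g : A → B) (xs : List A) →
              listSum (map f (map g xs)) ≡ listSum (map (f ∘ g) xs)
sum-map-map f g xs = cong listSum (sym (List.map-∘ xs))

sum-map-allFin : ∀ n (f : Fin n → ℕ) → listSum (map f (allFin n)) ≡ ∑[ i < n ] f i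
sum-map-allFin n f = trans (cong listSum (List.map-tabulate (λ i → i) f)) (sum-tabulate n f)
  where
  sum-tabulate : ∀ n (f : Fin n → ℕ) → listSum (tabulate f) ≡ ∑[ i < n ] f i
  sum-tabulate zero    f = refl
  sum-tabulate (suc n) f = cong (f zero +_) (sum-tabulate n (f ∘ suc))

sum-map-cartesianProduct : (f : A × B → ℕ) (xs : List A) (ys : List B) →
  listSum (map f (cartesianProduct xs ys)) ≡ listSum (map (λ x → listSum (map (λ y → f (x , y)) ys)) xs)
sum-map-cartesianProduct f [] ys = refl
sum-map-cartesianProduct f (x ∷ xs) ys = begin
  listSum (map f (map (x ,_) ys ++ cartesianProduct xs ys))
    ≡⟨ sum-map-++ f (map (x ,_) ys) (cartesianProduct xs ys) ⟩
  listSum (map f (map (x ,_) ys)) + listSum (map f (cartesianProduct xs ys))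
    ≡⟨ cong₂ _+_ (sum-map-map f (x ,_) ys) (sum-map-cartesianProduct f xs ys) ⟩
  listSum (map (λ y → f (x , y)) ys) + listSum (map (λ x → listSum (map (λ y → f (x , y)) ys)) xs) ∎
  where open ≡-Reasoning

count-Fin : ∀ n {P : Fin n → Set} (P? : Decidable P) → count (Fin-enumeration n) P? ≡ ∑[ i < n ] indicator (P? i)
count-Fin n P? = sum-map-allFin n (indicator ∘ P?)

count-⊎ : (e : Enumeration A) (e′ : Enumeration B) {P : A ⊎ B → Set} (P? : Decidable P) →
          count (e ⊎-enumeration e′) P? ≡ count e (P? ∘ inj₁) + count e′ (P? ∘ inj₂)
count-⊎ e e′ P? = trans (sum-map-++ (indicator ∘ P?) (map inj₁ (elements e)) (map inj₂ (elements e′)))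
  (cong₂ _+_ (sum-map-map (indicator ∘ P?) inj₁ (elements e)) (sum-map-map (indicator ∘ P?) inj₂ (elements e′)))

count-Fin× : ∀ n (e : Enumeration B) {P : Fin n × B → Set} (P? : Decidable P) →
             count (Fin-enumeration n ×-enumeration e) P? ≡ ∑[ i < n ] count e (λ y → P? (i , y))
count-Fin× n e P? = trans (sum-map-cartesianProduct (indicator ∘ P?) (allFin n) (elements e))
                          (sum-map-allFin n (λ i → count e (λ y → P? (i , y))))

≤-+⇔split : ∀ N m n → N ≤ m + n ⇔ ∃ λ j → j ≤ N × j ≤ m × N ∸ j ≤ n
≤-+⇔split N m n = mk⇔ to (λ (j , _ , j≤m , N∸j≤n) → ≤-trans (m≤n+m∸n N j) (+-mono-≤ j≤m N∸j≤n))
  where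
  to : N ≤ m + n → ∃ λ j → j ≤ N × j ≤ m × N ∸ j ≤ n
  to N≤m+n with ≤-total N m
  ... | inj₁ N≤m = N , ≤-refl , N≤m , ≤-trans (≤-reflexive (n∸n≡0 N)) z≤n
  ... | inj₂ m≤N = m , m≤N , ≤-refl , m≤n+o⇒m∸n≤o N m N≤m+n

≤⇔+-double : ∀ m n → m ≤ n ⇔ m + m ≤ n + n
≤⇔+-double m n = mk⇔ (λ m≤n → +-mono-≤ m≤n m≤n) from
  where
  from : m + m ≤ n + n → m ≤ n
  from m+m≤n+n with m ≤? n
  ... | yes m≤n = m≤n
  ... | no  m≰n = ⊥-elim (<⇒≱ (+-mono-< (≰⇒> m≰n) (≰⇒> m≰n)) m+m≤n+n)

⊓-+-subadditive : ∀ m n o → m ⊓ (n + o) ≤ n ⊓ m + m ⊓ o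
⊓-+-subadditive m n o with ≤-total n m
... | inj₁ n≤m = begin
  m ⊓ (n + o)        ≤⟨ ⊓-monoˡ-≤ (n + o) (m≤n+m m n) ⟩
  (n + m) ⊓ (n + o)  ≡⟨ +-distribˡ-⊓ n m o ⟨
  n + m ⊓ o          ≡⟨ cong (_+ m ⊓ o) (m≤n⇒m⊓n≡m n≤m) ⟨
  n ⊓ m + m ⊓ o      ∎
  where open ≤-Reasoning
... | inj₂ m≤n = begin
  m ⊓ (n + o)    ≤⟨ m⊓n≤m m (n + o) ⟩
  m              ≡⟨ m≥n⇒m⊓n≡n m≤n ⟨
  n ⊓ m          ≤⟨ m≤m+n (n ⊓ m) (m ⊓ o) ⟩
  n ⊓ m + m ⊓ o  ∎
  where open ≤-Reasoning

⊓-∑-≤ : ∀ {n} N (f : Fin n → ℕ) → N ⊓ ∑[ i < n ] f i ≤ ∑[ i < n ] (f i ⊓ N)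
⊓-∑-≤ {zero}  N f = ≤-reflexive (⊓-zeroʳ N)
⊓-∑-≤ {suc n} N f = ≤-trans (⊓-+-subadditive N (f zero) _) (+-monoʳ-≤ (f zero ⊓ N) (⊓-∑-≤ N (f ∘ suc)))

≤-∑⊓⇔≤-∑ : ∀ {n} N (f : Fin n → ℕ) → N ≤ ∑[ i < n ] (f i ⊓ N) ⇔ N ≤ ∑[ i < n ] f i
≤-∑⊓⇔≤-∑ {n} N f = mk⇔
  (λ N≤ → ≤-trans N≤ (∑-mono (λ i → m⊓n≤m (f i) N)))
  (λ N≤ → ≤-trans (≤-reflexive (sym (m≤n⇒m⊓n≡m N≤))) (⊓-∑-≤ N f))
  where
  ∑-mono : ∀ {n} {f g : Fin n → ℕ} → (∀ i → f i ≤ g i) → ∑[ i < n ] f i ≤ ∑[ i < n ] g i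
  ∑-mono {zero}  f≤g = z≤n
  ∑-mono {suc n} f≤g = +-mono-≤ (f≤g zero) (∑-mono (f≤g ∘ suc))

⊓-suc : ∀ d t → d ⊓ t + indicator (suc t ≤? d) ≡ d ⊓ suc t
⊓-suc d t with suc t ≤? d
... | yes t<d = begin
  d ⊓ t + indicator (suc t ≤? d)  ≡⟨ cong (d ⊓ t +_) (indicator-yes (suc t ≤? d) t<d) ⟩
  d ⊓ t + 1                       ≡⟨ cong (_+ 1) (m≥n⇒m⊓n≡n (<⇒≤ t<d)) ⟩
  t + 1                           ≡⟨ +-comm t 1 ⟩
  suc t                           ≡⟨ m≥n⇒m⊓n≡n t<d ⟨
  d ⊓ suc t                       ∎
  where open ≡-Reasoning
... | no  t≮d = begin
  d ⊓ t + indicator (suc t ≤? d)  ≡⟨ cong (d ⊓ t +_) (indicator-no (suc t ≤? d) t≮d) ⟩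
  d ⊓ t + 0                       ≡⟨ +-identityʳ (d ⊓ t) ⟩
  d ⊓ t                           ≡⟨ m≤n⇒m⊓n≡m (≤-pred (≰⇒> t≮d)) ⟩
  d                               ≡⟨ m≤n⇒m⊓n≡m (m≤n⇒m≤1+n (≤-pred (≰⇒> t≮d))) ⟨
  d ⊓ suc t                       ∎
  where open ≡-Reasoning

update-same : ∀ {m} {V : Set} (ρ : Assignment m V) x v → update ρ x v x ≡ just v
update-same ρ x v with x Fin.≟ x
... | yes _   = refl
... | no  x≢x = ⊥-elim (x≢x refl)

update-other : ∀ {m} {V : Set} (ρ : Assignment m V) {x j} v → j ≢ x → update ρ x v j ≡ ρ j
update-other ρ {x} {j} v j≢x with j Fin.≟ x
... | yes j≡x = ⊥-elim (j≢x j≡x)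
... | no  _   = refl

liftRel-just : {R : A → A → Set} {ma mb : Maybe A} {a b : A} →
               ma ≡ just a → mb ≡ just b → liftRel R ma mb ⇔ R a b
liftRel-just refl refl = ⇔-refl

liftRel? : {R : A → A → Set} → (∀ a b → Dec (R a b)) → ∀ ma mb → Dec (liftRel R ma mb)
liftRel? R? (just a) (just b) = R? a b
liftRel? R? (just a) nothing  = no λ ()
liftRel? R? nothing  _        = no λ ()

module Connectives {m} (z : Fin m) where

  ⊤′ ⊥′ : Formula m
  ⊤′ = exists≥ 0 z (equal z z)
  ⊥′ = neg ⊤′

  _∨′_ : Formula m → Formula m → Formula m
  φ ∨′ ψ = neg (conj (neg φ) (neg ψ))

  ⋁≤ : ℕ → (ℕ → Formula m) → Formula m
  ⋁≤ zero    φ = φ zero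
  ⋁≤ (suc t) φ = φ (suc t) ∨′ ⋁≤ t φ

  sat-⊤′ : ∀ (𝔄 : Structure) ρ → Sat 𝔄 ⊤′ ρ
  sat-⊤′ 𝔄 ρ = (λ ()) , (λ { {()} }) , (λ ())

  sat-⊥′ : ∀ (𝔄 : Structure) ρ → ¬ Sat 𝔄 ⊥′ ρ
  sat-⊥′ 𝔄 ρ ¬⊤ = ¬⊤ (sat-⊤′ 𝔄 ρ)

  module _ {𝔄 : Structure} (sat? : ∀ φ ρ → Dec (Sat {m} 𝔄 φ ρ)) where

    sat-∨′ : ∀ φ ψ ρ → Sat 𝔄 (φ ∨′ ψ) ρ ⇔ (Sat 𝔄 φ ρ ⊎ Sat 𝔄 ψ ρ)
    sat-∨′ φ ψ ρ = mk⇔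
      (λ ¬[¬φ∧¬ψ] → decidable-stable (sat? φ ρ ⊎-dec sat? ψ ρ) λ ¬φ∨ψ → ¬[¬φ∧¬ψ] (¬φ∨ψ ∘ inj₁ , ¬φ∨ψ ∘ inj₂))
      (λ { (inj₁ sφ) (¬φ , _) → ¬φ sφ ; (inj₂ sψ) (_ , ¬ψ) → ¬ψ sψ })

    sat-⋁≤ : ∀ t φ ρ → Sat 𝔄 (⋁≤ t φ) ρ ⇔ ∃ λ j → j ≤ t × Sat 𝔄 (φ j) ρ
    sat-⋁≤ zero φ ρ = mk⇔ (λ s → zero , z≤n , s) (λ { (.zero , z≤n , s) → s })
    sat-⋁≤ (suc t) φ ρ = ⇔-trans (sat-∨′ (φ (suc t)) (⋁≤ t φ) ρ) (mk⇔ to from)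
      where
      to : Sat 𝔄 (φ (suc t)) ρ ⊎ Sat 𝔄 (⋁≤ t φ) ρ → ∃ λ j → j ≤ suc t × Sat 𝔄 (φ j) ρ
      to (inj₁ s) = suc t , ≤-refl , s
      to (inj₂ s) with Equivalence.to (sat-⋁≤ t φ ρ) s
      ... | j , j≤t , s′ = j , m≤n⇒m≤1+n j≤t , s′
      from : (∃ λ j → j ≤ suc t × Sat 𝔄 (φ j) ρ) → Sat 𝔄 (φ (suc t)) ρ ⊎ Sat 𝔄 (⋁≤ t φ) ρ
      from (j , j≤1+t , s) with m≤n⇒m<n∨m≡n j≤1+t
      ... | inj₂ refl  = inj₁ s
      ... | inj₁ j<1+t = inj₂ (Equivalence.from (sat-⋁≤ t φ ρ) (j , ≤-pred j<1+t , s))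

module _ {n} (G : Graph n) where

  Adj : Fin n → Fin n → Set
  Adj a b = Graph.adj G a b ≡ true

  Adj? : ∀ a b → Dec (Adj a b)
  Adj? a b = Graph.adj G a b Bool.≟ true

  sat? : ∀ {m} (φ : Formula m) σ → Dec (Sat (toStr G) φ σ)
  sat? (edge i j)      σ = liftRel? Adj? (σ i) (σ j)
  sat? (equal i j)     σ = liftRel? Fin._≟_ (σ i) (σ j)
  sat? (neg φ)         σ = ¬? (sat? φ σ)
  sat? (conj φ ψ)      σ = sat? φ σ ×-dec sat? ψ σ
  sat? (exists≥ c x φ) σ =
    Dec.map (⇔-sym (atLeast⇔count (Fin-enumeration n) (λ a → sat? φ (update σ x a)) c)) (c ≤? _)

-- Counting formulas

module CountingFormulas {m} (z : Fin m) where
  open Connectives z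

  zeroᶜ : ℕ → Formula m
  zeroᶜ zero    = ⊤′
  zeroᶜ (suc _) = ⊥′

  _⊕_ : (ℕ → Formula m) → (ℕ → Formula m) → ℕ → Formula m
  (θ₁ ⊕ θ₂) N = ⋁≤ N λ j → conj (θ₁ j) (θ₂ (N ∸ j))

  witnesses : Fin m → Formula m → ℕ → Formula m
  witnesses x ψ j = exists≥ j x ψ

  -- ∑_{s=1}^{t} #{x | ∃^{≥s} y ψ} = ∑_x min(#{y | ψ}, t), using only the variables x and y.
  truncatedPairs : Fin m → Fin m → Formula m → ℕ → ℕ → Formula m
  truncatedPairs x y ψ zero    = zeroᶜ
  truncatedPairs x y ψ (suc t) = truncatedPairs x y ψ t ⊕ witnesses x (exists≥ (suc t) y ψ)

  pairs : Fin m → Fin m → Formula m → ℕ → Formula m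
  pairs x y ψ N = truncatedPairs x y ψ N N

module CountingSemantics {n} (G : Graph n) {m} (z : Fin m) where
  open Connectives z
  open CountingFormulas z

  record Counts (θ : ℕ → Formula m) (f : Assignment m (Fin n) → ℕ) : Set where
    constructor counts
    field sat⇔≤ : ∀ σ j → Sat (toStr G) (θ j) σ ⇔ j ≤ f σ
  open Counts

  degree : Fin m → Formula m → Assignment m (Fin n) → ℕ
  degree x ψ σ = ∑[ a < n ] indicator (sat? G ψ (update σ x a))

  Counts-cong : ∀ {θ f g} → (∀ σ → f σ ≡ g σ) → Counts θ f → Counts θ g
  Counts-cong f≡g θ-f = counts λ σ j → ⇔-trans (sat⇔≤ θ-f σ j) (≤-congʳ (f≡g σ))

  counts-zero : Counts zeroᶜ (λ _ → 0)
  counts-zero = counts λ where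
    σ zero    → mk⇔ (λ _ → z≤n) (λ _ → sat-⊤′ (toStr G) σ)
    σ (suc j) → mk⇔ (λ s → ⊥-elim (sat-⊥′ (toStr G) σ s)) (λ ())

  counts-⊕ : ∀ {θ₁ θ₂ f₁ f₂} → Counts θ₁ f₁ → Counts θ₂ f₂ → Counts (θ₁ ⊕ θ₂) (λ σ → f₁ σ + f₂ σ)
  counts-⊕ {θ₁} {θ₂} {f₁} {f₂} θ₁-f₁ θ₂-f₂ = counts λ σ N → let open ⇔-Reasoning in begin
    Sat (toStr G) ((θ₁ ⊕ θ₂) N) σ                                         ≈⟨ sat-⋁≤ (sat? G) N _ σ ⟩
    (∃ λ j → j ≤ N × Sat (toStr G) (θ₁ j) σ × Sat (toStr G) (θ₂ (N ∸ j)) σ) ≈⟨ split⇔ σ N ⟩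
    (∃ λ j → j ≤ N × j ≤ f₁ σ × N ∸ j ≤ f₂ σ)                              ≈⟨ ≤-+⇔split N (f₁ σ) (f₂ σ) ⟨
    N ≤ f₁ σ + f₂ σ                                                        ∎
    where
    split⇔ : ∀ σ N → (∃ λ j → j ≤ N × Sat (toStr G) (θ₁ j) σ × Sat (toStr G) (θ₂ (N ∸ j)) σ) ⇔
                     (∃ λ j → j ≤ N × j ≤ f₁ σ × N ∸ j ≤ f₂ σ)
    split⇔ σ N = mk⇔
      (λ (j , j≤N , s₁ , s₂) → j , j≤N , Equivalence.to (sat⇔≤ θ₁-f₁ σ j) s₁ , Equivalence.to (sat⇔≤ θ₂-f₂ σ (N ∸ j)) s₂)
      (λ (j , j≤N , j≤ , N∸j≤) → j , j≤N , Equivalence.from (sat⇔≤ θ₁-f₁ σ j) j≤ , Equivalence.from (sat⇔≤ θ₂-f₂ σ (N ∸ j)) N∸j≤)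

  counts-witnesses : ∀ x ψ → Counts (witnesses x ψ) (degree x ψ)
  counts-witnesses x ψ = counts λ σ j →
    ⇔-trans (atLeast⇔count (Fin-enumeration n) (λ a → sat? G ψ (update σ x a)) j)
            (≤-congʳ (count-Fin n (λ a → sat? G ψ (update σ x a))))

  counts-pairs : ∀ x y ψ → Counts (pairs x y ψ) (λ σ → ∑[ a < n ] degree y ψ (update σ x a))
  counts-pairs x y ψ = counts λ σ N →
    ⇔-trans (sat⇔≤ (counts-truncated N) σ N) (≤-∑⊓⇔≤-∑ N (λ a → degree y ψ (update σ x a)))
    where
    d : Assignment m (Fin n) → Fin n → ℕ
    d σ a = degree y ψ (update σ x a)

    indicator-witnesses : ∀ σ t a → indicator (sat? G (exists≥ (suc t) y ψ) (update σ x a)) ≡ indicator (suc t ≤? d σ a)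
    indicator-witnesses σ t a = indicator-cong (sat⇔≤ (counts-witnesses y ψ) (update σ x a) (suc t))
      (sat? G (exists≥ (suc t) y ψ) (update σ x a)) (suc t ≤? d σ a)

    counts-truncated : ∀ t → Counts (truncatedPairs x y ψ t) (λ σ → ∑[ a < n ] (d σ a ⊓ t))
    counts-truncated zero = Counts-cong
      (λ σ → sym (trans (sum-cong-≗ (λ a → ⊓-zeroʳ (d σ a))) (sum-replicate-zero n)))
      counts-zero
    counts-truncated (suc t) = Counts-cong step
      (counts-⊕ (counts-truncated t) (counts-witnesses x (exists≥ (suc t) y ψ)))
      where
      step : ∀ σ → ∑[ a < n ] (d σ a ⊓ t) + degree x (exists≥ (suc t) y ψ) σ ≡ ∑[ a < n ] (d σ a ⊓ suc t)
      step σ = begin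
        ∑[ a < n ] (d σ a ⊓ t) + degree x (exists≥ (suc t) y ψ) σ
          ≡⟨ cong (∑[ a < n ] (d σ a ⊓ t) +_) (sum-cong-≗ (indicator-witnesses σ t)) ⟩
        ∑[ a < n ] (d σ a ⊓ t) + ∑[ a < n ] indicator (suc t ≤? d σ a)
          ≡⟨ ∑-distrib-+ (λ a → d σ a ⊓ t) _ ⟨
        ∑[ a < n ] (d σ a ⊓ t + indicator (suc t ≤? d σ a))
          ≡⟨ sum-cong-≗ (λ a → ⊓-suc (d σ a) t) ⟩
        ∑[ a < n ] (d σ a ⊓ suc t) ∎
        where open ≡-Reasoning

-- Vertices of the subdivision encoded by pairs of vertices

_≈ᵤ_ : A × A → A × A → Set
(a , b) ≈ᵤ (a′ , b′) = (a ≡ a′ × b ≡ b′) ⊎ (a ≡ b′ × b ≡ a′)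

≈ᵤ-sym : {p q : A × A} → p ≈ᵤ q → q ≈ᵤ p
≈ᵤ-sym (inj₁ (refl , refl)) = inj₁ (refl , refl)
≈ᵤ-sym (inj₂ (refl , refl)) = inj₂ (refl , refl)

≈ᵤ-trans : {p q r : A × A} → p ≈ᵤ q → q ≈ᵤ r → p ≈ᵤ r
≈ᵤ-trans (inj₁ (refl , refl)) q≈r                  = q≈r
≈ᵤ-trans (inj₂ (refl , refl)) (inj₁ (refl , refl)) = inj₂ (refl , refl)
≈ᵤ-trans (inj₂ (refl , refl)) (inj₂ (refl , refl)) = inj₁ (refl , refl)

≈ᵤ-< : ∀ {n} {a b a′ b′ : Fin n} → a Fin.< b → a′ Fin.< b′ → (a , b) ≈ᵤ (a′ , b′) → a ≡ a′ × b ≡ b′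
≈ᵤ-< _   _     (inj₁ eq)            = eq
≈ᵤ-< a<b a′<b′ (inj₂ (refl , refl)) = ⊥-elim (Fin.<-asym a<b a′<b′)

≈ᵤ-diag : ∀ {v a b : A} → (v , v) ≈ᵤ (a , b) → a ≡ b
≈ᵤ-diag (inj₁ (refl , refl)) = refl
≈ᵤ-diag (inj₂ (refl , refl)) = refl

≈ᵤ-ends : ∀ {v a b a′ b′ : A} → (a , b) ≈ᵤ (a′ , b′) → (v ≡ a ⊎ v ≡ b) ⇔ (v ≡ a′ ⊎ v ≡ b′)
≈ᵤ-ends (inj₁ (refl , refl)) = ⇔-refl
≈ᵤ-ends (inj₂ (refl , refl)) = mk⇔ swap swap

module _ {n} (G : Graph n) where

  Adj-sym : ∀ {a b} → Adj G a b → Adj G b a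
  Adj-sym {a} {b} ab = trans (Graph.sym G b a) ab

  Adj-irrefl : ∀ {a} → ¬ Adj G a a
  Adj-irrefl {a} aa with trans (sym aa) (Graph.irrefl G a)
  ... | ()

  IsEdge : Fin n → Fin n → Set
  IsEdge a b = a Fin.< b × Adj G a b

  IsEdge-irrelevant : ∀ {a b} (e e′ : IsEdge a b) → e ≡ e′
  IsEdge-irrelevant (a<b , ab) (a<b′ , ab′) =
    cong₂ _,_ (Fin.<-irrelevant a<b a<b′) (Decidable⇒UIP.≡-irrelevant Bool._≟_ ab ab′)

  Encodes : SubV G → Fin n → Fin n → Set
  Encodes (inj₁ v)        a b = a ≡ v × b ≡ v
  Encodes (inj₂ (pq , _)) a b = (a , b) ≈ᵤ pq

  encodes-≢ : ∀ {p q a b} (e : IsEdge p q) → Encodes (inj₂ ((p , q) , e)) a b → a ≢ b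
  encodes-≢ (p<q , _) (inj₁ (refl , refl)) = Fin.<⇒≢ p<q
  encodes-≢ (p<q , _) (inj₂ (refl , refl)) = Fin.<⇒≢ p<q ∘ sym

  encodes-Adj : ∀ {p q a b} (e : IsEdge p q) → Encodes (inj₂ ((p , q) , e)) a b → Adj G a b
  encodes-Adj (_ , pq) (inj₁ (refl , refl)) = pq
  encodes-Adj (_ , pq) (inj₂ (refl , refl)) = Adj-sym pq

  encodes-≈ᵤ : ∀ {w a b a′ b′} → Encodes w a b → Encodes w a′ b′ → (a , b) ≈ᵤ (a′ , b′)
  encodes-≈ᵤ {inj₁ v} (refl , refl) (refl , refl) = inj₁ (refl , refl)
  encodes-≈ᵤ {inj₂ _} enc enc′ = ≈ᵤ-trans enc (≈ᵤ-sym enc′)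

module SubdivisionCount {n} (G : Graph n) {P : SubV G → Set} {T : Fin n → Fin n → Set}
                        (T? : ∀ a b → Dec (T a b)) (P⇔T : ∀ w a b → Encodes G w a b → P w ⇔ T a b) where

  Forward : Fin n → Fin n → Set
  Forward a b = a Fin.< b × Adj G a b × T a b

  Forward? : ∀ a b → Dec (Forward a b)
  Forward? a b = a Fin.<? b ×-dec Adj? G a b ×-dec T? a b

  loops edges arcs : ℕ
  loops = ∑[ a < n ] indicator (T? a a)
  edges = ∑[ a < n ] ∑[ b < n ] indicator (Forward? a b)
  arcs  = ∑[ a < n ] ∑[ b < n ] indicator (Adj? G a b ×-dec T? a b)

  private
    codes : Enumeration (Fin n ⊎ Fin n × Fin n)
    codes = Fin-enumeration n ⊎-enumeration (Fin-enumeration n ×-enumeration Fin-enumeration n)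

    code : SubV G → Fin n ⊎ Fin n × Fin n
    code (inj₁ v)        = inj₁ v
    code (inj₂ (pq , _)) = inj₂ pq

    code-injective : Injective _≡_ _≡_ code
    code-injective {inj₁ v}       {inj₁ .v}       refl = refl
    code-injective {inj₂ (pq , e)} {inj₂ (.pq , e′)} refl = cong (λ e → inj₂ (pq , e)) (IsEdge-irrelevant G e e′)

    Q : Fin n ⊎ Fin n × Fin n → Set
    Q (inj₁ a)       = T a a
    Q (inj₂ (a , b)) = Forward a b

    Q? : ∀ w → Dec (Q w)
    Q? (inj₁ a)       = T? a a
    Q? (inj₂ (a , b)) = Forward? a b

    P⇔Q∘code : ∀ w → P w ⇔ Q (code w)
    P⇔Q∘code (inj₁ v) = P⇔T (inj₁ v) v v (refl , refl)
    P⇔Q∘code w@(inj₂ ((a , b) , a<b , ab)) =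
      ⇔-trans (P⇔T w a b (inj₁ (refl , refl))) (mk⇔ (λ t → a<b , ab , t) (proj₂ ∘ proj₂))

    Q⇒image : ∀ y → Q y → ∃ λ w → code w ≡ y
    Q⇒image (inj₁ a)       _              = inj₁ a , refl
    Q⇒image (inj₂ (a , b)) (a<b , ab , _) = inj₂ ((a , b) , a<b , ab) , refl

  atLeast⇔≤loops+edges : ∀ c → AtLeast c P ⇔ c ≤ loops + edges
  atLeast⇔≤loops+edges c = begin
    AtLeast c P          ≈⟨ AtLeast-image code code-injective P⇔Q∘code Q⇒image c ⟩
    AtLeast c Q          ≈⟨ atLeast⇔count codes Q? c ⟩
    c ≤ count codes Q?   ≈⟨ ≤-congʳ count≡ ⟩
    c ≤ loops + edges    ∎
    where
    open ⇔-Reasoning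
    count≡ : count codes Q? ≡ loops + edges
    count≡ = trans (count-⊎ (Fin-enumeration n) (Fin-enumeration n ×-enumeration Fin-enumeration n) Q?)
      (cong₂ _+_ (count-Fin n (Q? ∘ inj₁))
                 (trans (count-Fin× n (Fin-enumeration n) (Q? ∘ inj₂)) (sum-cong-≗ λ a → count-Fin n (Forward? a))))

  T-sym : ∀ {a b} → Adj G a b → T a b → T b a
  T-sym {a} {b} ab t with Fin.<-cmp a b
  ... | tri< a<b _ _ = let w = inj₂ ((a , b) , a<b , ab) in
    Equivalence.to (P⇔T w b a (inj₂ (refl , refl))) (Equivalence.from (P⇔T w a b (inj₁ (refl , refl))) t)
  ... | tri≈ _ refl _ = t
  ... | tri> _ _ b<a = let w = inj₂ ((b , a) , b<a , Adj-sym G ab) in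
    Equivalence.to (P⇔T w b a (inj₁ (refl , refl))) (Equivalence.from (P⇔T w a b (inj₂ (refl , refl))) t)

  arc-split : ∀ a b → indicator (Adj? G a b ×-dec T? a b) ≡ indicator (Forward? a b) + indicator (Forward? b a)
  arc-split a b with Fin.<-cmp a b
  ... | tri< a<b _ b≮a = begin
    indicator (Adj? G a b ×-dec T? a b)
      ≡⟨ indicator-cong (mk⇔ (λ (ab , t) → a<b , ab , t) proj₂) (Adj? G a b ×-dec T? a b) (Forward? a b) ⟩
    indicator (Forward? a b)      ≡⟨ +-identityʳ _ ⟨
    indicator (Forward? a b) + 0  ≡⟨ cong (indicator (Forward? a b) +_) (indicator-no (Forward? b a) (b≮a ∘ proj₁)) ⟨
    indicator (Forward? a b) + indicator (Forward? b a) ∎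
    where open ≡-Reasoning
  ... | tri≈ a≮a refl _ = begin
    indicator (Adj? G a a ×-dec T? a a)  ≡⟨ indicator-no (Adj? G a a ×-dec T? a a) (Adj-irrefl G ∘ proj₁) ⟩
    0                                    ≡⟨ cong₂ _+_ (indicator-no (Forward? a a) (a≮a ∘ proj₁)) (indicator-no (Forward? a a) (a≮a ∘ proj₁)) ⟨
    indicator (Forward? a a) + indicator (Forward? a a) ∎
    where open ≡-Reasoning
  ... | tri> a≮b _ b<a = begin
    indicator (Adj? G a b ×-dec T? a b)
      ≡⟨ indicator-cong (mk⇔ (λ (ab , t) → b<a , Adj-sym G ab , T-sym ab t) (λ (_ , ba , t) → Adj-sym G ba , T-sym ba t))
                        (Adj? G a b ×-dec T? a b) (Forward? b a) ⟩
    indicator (Forward? b a)      ≡⟨ cong (_+ indicator (Forward? b a)) (indicator-no (Forward? a b) (a≮b ∘ proj₁)) ⟨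
    indicator (Forward? a b) + indicator (Forward? b a) ∎
    where open ≡-Reasoning

  arcs≡edges+edges : arcs ≡ edges + edges
  arcs≡edges+edges = begin
    ∑[ a < n ] ∑[ b < n ] indicator (Adj? G a b ×-dec T? a b)
      ≡⟨ sum-cong-≗ (λ a → trans (sum-cong-≗ (arc-split a)) (∑-distrib-+ (λ b → indicator (Forward? a b)) (λ b → indicator (Forward? b a)))) ⟩
    ∑[ a < n ] (∑[ b < n ] indicator (Forward? a b) + ∑[ b < n ] indicator (Forward? b a))
      ≡⟨ ∑-distrib-+ (λ a → ∑[ b < n ] indicator (Forward? a b)) (λ a → ∑[ b < n ] indicator (Forward? b a)) ⟩
    edges + ∑[ a < n ] ∑[ b < n ] indicator (Forward? b a)
      ≡⟨ cong (edges +_) (∑-comm (λ a b → indicator (Forward? b a))) ⟩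
    edges + edges ∎
    where open ≡-Reasoning

-- Translation of C_k over G¹ into C_m over G

module Translation {k m} (l r : Fin k → Fin m) (z : Fin m) where
  open Connectives z
  open CountingFormulas z

  isVertex isEdge : Fin k → Formula m
  isVertex i = equal (l i) (r i)
  isEdge   i = edge (l i) (r i)

  incident : Fin k → Fin k → Formula m
  incident i j = conj (isVertex i) (conj (isEdge j) (equal (l i) (l j) ∨′ equal (l i) (r j)))

  loopWitnesses arcPairs : Fin k → Formula m → ℕ → Formula m
  loopWitnesses x ψ = witnesses (l x) (exists≥ 1 (r x) (conj (isVertex x) ψ))
  arcPairs      x ψ = pairs (l x) (r x) (conj (isEdge x) ψ)

  translate : Formula k → Formula m
  translate (edge i j)      = incident i j ∨′ incident j i
  translate (equal i j)     = conj (equal (l i) (l j)) (equal (r i) (r j)) ∨′ conj (equal (l i) (r j)) (equal (r i) (l j))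
  translate (neg φ)         = neg (translate φ)
  translate (conj φ ψ)      = conj (translate φ) (translate ψ)
  translate (exists≥ c x φ) = ((loopWitnesses x (translate φ) ⊕ loopWitnesses x (translate φ)) ⊕ arcPairs x (translate φ)) (c + c)

module Correspondence {n} (G : Graph n) {k m} (l r : Fin k → Fin m)
                      (l-injective : Injective _≡_ _≡_ l) (r-injective : Injective _≡_ _≡_ r)
                      (l≢r : ∀ i j → l i ≢ r j) (z : Fin m) where
  open Connectives z
  open CountingFormulas z
  open Translation l r z
  open CountingSemantics G z

  𝔊 : Structure
  𝔊 = toStr G

  Encodesᴹ : Maybe (SubV G) → Maybe (Fin n) → Maybe (Fin n) → Set
  Encodesᴹ nothing  ma mb = ma ≡ nothing × mb ≡ nothing
  Encodesᴹ (just w) ma mb = ∃ λ a → ∃ λ b → ma ≡ just a × mb ≡ just b × Encodes G w a b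

  Represents : Assignment k (SubV G) → Assignment m (Fin n) → Set
  Represents ρ σ = ∀ i → Encodesᴹ (ρ i) (σ (l i)) (σ (r i))

  update₂ : Assignment m (Fin n) → Fin k → Fin n → Fin n → Assignment m (Fin n)
  update₂ σ x a b = update (update σ (l x) a) (r x) b

  update₂-l : ∀ σ x a b → update₂ σ x a b (l x) ≡ just a
  update₂-l σ x a b = trans (update-other (update σ (l x) a) b (l≢r x x)) (update-same σ (l x) a)

  update₂-r : ∀ σ x a b → update₂ σ x a b (r x) ≡ just b
  update₂-r σ x a b = update-same (update σ (l x) a) (r x) b

  represents-update : ∀ {ρ σ x w a b} → Represents ρ σ → Encodes G w a b →
                      Represents (update ρ x w) (update₂ σ x a b)
  represents-update {ρ} {σ} {x} {w} {a} {b} rep enc i with i Fin.≟ x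
  ... | yes refl = a , b , update₂-l σ x a b , update₂-r σ x a b , enc
  ... | no  i≢x  = subst₂ (Encodesᴹ (ρ i)) (sym l-unchanged) (sym r-unchanged) (rep i)
    where
    l-unchanged : update₂ σ x a b (l i) ≡ σ (l i)
    l-unchanged = trans (update-other (update σ (l x) a) b (l≢r i x)) (update-other σ a (i≢x ∘ l-injective))
    r-unchanged : update₂ σ x a b (r i) ≡ σ (r i)
    r-unchanged = trans (update-other (update σ (l x) a) b (i≢x ∘ r-injective)) (update-other σ a (l≢r x i ∘ sym))

  Incident : (ma mb ma′ mb′ : Maybe (Fin n)) → Set
  Incident ma mb ma′ mb′ = liftRel _≡_ ma mb × liftRel (Adj G) ma′ mb′ × (liftRel _≡_ ma ma′ ⊎ liftRel _≡_ ma mb′)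

  SameEnds : (ma mb ma′ mb′ : Maybe (Fin n)) → Set
  SameEnds ma mb ma′ mb′ = (liftRel _≡_ ma ma′ × liftRel _≡_ mb mb′) ⊎ (liftRel _≡_ ma mb′ × liftRel _≡_ mb ma′)

  sat-translate-edge : ∀ i j σ → Sat 𝔊 (translate (edge i j)) σ ⇔
    (Incident (σ (l i)) (σ (r i)) (σ (l j)) (σ (r j)) ⊎ Incident (σ (l j)) (σ (r j)) (σ (l i)) (σ (r i)))
  sat-translate-edge i j σ = ⇔-trans (sat-∨′ (sat? G) (incident i j) (incident j i) σ)
    (incident⇔ i j ⊎-⇔ incident⇔ j i)
    where
    incident⇔ : ∀ i j → Sat 𝔊 (incident i j) σ ⇔ Incident (σ (l i)) (σ (r i)) (σ (l j)) (σ (r j))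
    incident⇔ i j = ⇔-refl ×-⇔ (⇔-refl ×-⇔ sat-∨′ (sat? G) (equal (l i) (l j)) (equal (l i) (r j)) σ)

  sat-translate-equal : ∀ i j σ → Sat 𝔊 (translate (equal i j)) σ ⇔ SameEnds (σ (l i)) (σ (r i)) (σ (l j)) (σ (r j))
  sat-translate-equal i j σ =
    sat-∨′ (sat? G) (conj (equal (l i) (l j)) (equal (r i) (r j))) (conj (equal (l i) (r j)) (equal (r i) (l j))) σ

  vertex-on-edge : ∀ v {p q a b} (e : IsEdge G p q) → Encodes G (inj₂ ((p , q) , e)) a b →
                   SubE G (inj₁ v) (inj₂ ((p , q) , e)) ⇔ Incident (just v) (just v) (just a) (just b)
  vertex-on-edge v e enc = mk⇔ (λ v∈pq → refl , encodes-Adj G e enc , Equivalence.from (≈ᵤ-ends enc) v∈pq)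
                                (λ (_ , _ , v∈ab) → Equivalence.to (≈ᵤ-ends enc) v∈ab)

  edge⇔incident : ∀ w w′ {a b a′ b′} → Encodes G w a b → Encodes G w′ a′ b′ →
    SubE G w w′ ⇔ (Incident (just a) (just b) (just a′) (just b′) ⊎ Incident (just a′) (just b′) (just a) (just b))
  edge⇔incident (inj₁ v) (inj₁ v′) (refl , refl) (refl , refl) =
    mk⇔ (λ ()) λ { (inj₁ (_ , v′v′ , _)) → Adj-irrefl G v′v′ ; (inj₂ (_ , vv , _)) → Adj-irrefl G vv }
  edge⇔incident (inj₁ v) (inj₂ (_ , e)) (refl , refl) enc′ =
    mk⇔ (inj₁ ∘ Equivalence.to (vertex-on-edge v e enc′))
        λ { (inj₁ inc) → Equivalence.from (vertex-on-edge v e enc′) inc ; (inj₂ (a′≡b′ , _)) → ⊥-elim (encodes-≢ G e enc′ a′≡b′) }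
  edge⇔incident (inj₂ (_ , e)) (inj₁ v′) enc (refl , refl) =
    mk⇔ (inj₂ ∘ Equivalence.to (vertex-on-edge v′ e enc))
        λ { (inj₂ inc) → Equivalence.from (vertex-on-edge v′ e enc) inc ; (inj₁ (a≡b , _)) → ⊥-elim (encodes-≢ G e enc a≡b) }
  edge⇔incident (inj₂ (_ , e)) (inj₂ (_ , e′)) enc enc′ =
    mk⇔ (λ ()) λ { (inj₁ (a≡b , _)) → encodes-≢ G e enc a≡b ; (inj₂ (a′≡b′ , _)) → encodes-≢ G e′ enc′ a′≡b′ }

  equal⇔≈ᵤ : ∀ w w′ {a b a′ b′} → Encodes G w a b → Encodes G w′ a′ b′ → (w ≡ w′) ⇔ (a , b) ≈ᵤ (a′ , b′)
  equal⇔≈ᵤ w w′ enc enc′ = mk⇔ (λ { refl → encodes-≈ᵤ G enc enc′ }) (from w w′ enc enc′)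
    where
    from : ∀ w w′ {a b a′ b′} → Encodes G w a b → Encodes G w′ a′ b′ → (a , b) ≈ᵤ (a′ , b′) → w ≡ w′
    from (inj₁ v) (inj₁ v′) (refl , refl) (refl , refl) (inj₁ (refl , _)) = refl
    from (inj₁ v) (inj₁ v′) (refl , refl) (refl , refl) (inj₂ (refl , _)) = refl
    from (inj₁ v) (inj₂ (_ , e′)) (refl , refl) enc′ same = ⊥-elim (encodes-≢ G e′ enc′ (≈ᵤ-diag same))
    from (inj₂ (_ , e)) (inj₁ v′) enc (refl , refl) same = ⊥-elim (encodes-≢ G e enc (≈ᵤ-diag (≈ᵤ-sym same)))
    from (inj₂ (pq , e)) (inj₂ (pq′ , e′)) enc enc′ same
      with ≈ᵤ-< (proj₁ e) (proj₁ e′) (≈ᵤ-trans (≈ᵤ-sym enc) (≈ᵤ-trans same enc′))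
    ... | refl , refl = cong (λ e → inj₂ (pq , e)) (IsEdge-irrelevant G e e′)

  edge-atom : ∀ {mw mw′ ma mb ma′ mb′} → Encodesᴹ mw ma mb → Encodesᴹ mw′ ma′ mb′ →
              liftRel (SubE G) mw mw′ ⇔ (Incident ma mb ma′ mb′ ⊎ Incident ma′ mb′ ma mb)
  edge-atom {nothing} (refl , refl) _ = mk⇔ (λ ()) λ { (inj₁ (() , _)) ; (inj₂ (_ , () , _)) }
  edge-atom {just _} {nothing} (_ , _ , refl , refl , _) (refl , refl) =
    mk⇔ (λ ()) λ { (inj₁ (_ , () , _)) ; (inj₂ (() , _)) }
  edge-atom {just w} {just w′} (_ , _ , refl , refl , enc) (_ , _ , refl , refl , enc′) = edge⇔incident w w′ enc enc′

  equal-atom : ∀ {mw mw′ ma mb ma′ mb′} → Encodesᴹ mw ma mb → Encodesᴹ mw′ ma′ mb′ →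
               liftRel _≡_ mw mw′ ⇔ SameEnds ma mb ma′ mb′
  equal-atom {nothing} (refl , refl) _ = mk⇔ (λ ()) λ { (inj₁ (() , _)) ; (inj₂ (() , _)) }
  equal-atom {just _} {nothing} (_ , _ , refl , refl , _) (refl , refl) =
    mk⇔ (λ ()) λ { (inj₁ (() , _)) ; (inj₂ (() , _)) }
  equal-atom {just w} {just w′} (_ , _ , refl , refl , enc) (_ , _ , refl , refl , enc′) = equal⇔≈ᵤ w w′ enc enc′

  sat-loop : ∀ x ψ σ a → Sat 𝔊 (exists≥ 1 (r x) (conj (isVertex x) ψ)) (update σ (l x) a) ⇔ Sat 𝔊 ψ (update₂ σ x a a)
  sat-loop x ψ σ a = mk⇔ to from
    where
    to : Sat 𝔊 (exists≥ 1 (r x) (conj (isVertex x) ψ)) (update σ (l x) a) → Sat 𝔊 ψ (update₂ σ x a a)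
    to (f , _ , s) = subst (λ b → Sat 𝔊 ψ (update₂ σ x a b)) (sym a≡f₀) (proj₂ (s zero))
      where
      a≡f₀ : a ≡ f zero
      a≡f₀ = Equivalence.to (liftRel-just (update₂-l σ x a (f zero)) (update₂-r σ x a (f zero))) (proj₁ (s zero))
    from : Sat 𝔊 ψ (update₂ σ x a a) → Sat 𝔊 (exists≥ 1 (r x) (conj (isVertex x) ψ)) (update σ (l x) a)
    from sψ = (λ _ → a) , (λ { {zero} {zero} _ → refl }) ,
              λ _ → Equivalence.from (liftRel-just (update₂-l σ x a a) (update₂-r σ x a a)) refl , sψ

  sat-arc : ∀ x ψ σ a b → Sat 𝔊 (conj (isEdge x) ψ) (update₂ σ x a b) ⇔ (Adj G a b × Sat 𝔊 ψ (update₂ σ x a b))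
  sat-arc x ψ σ a b = liftRel-just (update₂-l σ x a b) (update₂-r σ x a b) ×-⇔ ⇔-refl

  sat-quantifier : ∀ x ψ σ N → Sat 𝔊 (((loopWitnesses x ψ ⊕ loopWitnesses x ψ) ⊕ arcPairs x ψ) N) σ ⇔
    N ≤ (∑[ a < n ] indicator (sat? G ψ (update₂ σ x a a)) + ∑[ a < n ] indicator (sat? G ψ (update₂ σ x a a)))
        + ∑[ a < n ] ∑[ b < n ] indicator (Adj? G a b ×-dec sat? G ψ (update₂ σ x a b))
  sat-quantifier x ψ σ N =
    ⇔-trans (Counts.sat⇔≤ (counts-⊕ (counts-⊕ loops loops) (counts-pairs (l x) (r x) (conj (isEdge x) ψ))) σ N)
            (≤-congʳ (cong₂ _+_ (cong₂ _+_ loops≡ loops≡) arcs≡))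
    where
    loops = counts-witnesses (l x) (exists≥ 1 (r x) (conj (isVertex x) ψ))
    loops≡ = sum-cong-≗ λ a → indicator-cong (sat-loop x ψ σ a) (sat? G (exists≥ 1 (r x) (conj (isVertex x) ψ)) (update σ (l x) a)) (sat? G ψ (update₂ σ x a a))
    arcs≡ = sum-cong-≗ λ a → sum-cong-≗ λ b →
      indicator-cong (sat-arc x ψ σ a b) (sat? G (conj (isEdge x) ψ) (update₂ σ x a b)) (Adj? G a b ×-dec sat? G ψ (update₂ σ x a b))

  translate-correct : ∀ φ {ρ σ} → Represents ρ σ → Sat (subdivide G) φ ρ ⇔ Sat 𝔊 (translate φ) σ
  translate-correct (edge i j)  {σ = σ} rep = ⇔-trans (edge-atom (rep i) (rep j)) (⇔-sym (sat-translate-edge i j σ))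
  translate-correct (equal i j) {σ = σ} rep = ⇔-trans (equal-atom (rep i) (rep j)) (⇔-sym (sat-translate-equal i j σ))
  translate-correct (neg φ)    rep = ¬-cong-⇔ (translate-correct φ rep)
  translate-correct (conj φ ψ) rep = translate-correct φ rep ×-⇔ translate-correct ψ rep
  translate-correct (exists≥ c x φ) {ρ} {σ} rep = begin
    AtLeast c (λ w → Sat (subdivide G) φ (update ρ x w))  ≈⟨ atLeast⇔≤loops+edges c ⟩
    c ≤ loops + edges                                    ≈⟨ ≤⇔+-double c (loops + edges) ⟩
    c + c ≤ (loops + edges) + (loops + edges)            ≡⟨ cong (c + c ≤_) (interchange loops edges loops edges) ⟩
    c + c ≤ (loops + loops) + (edges + edges)            ≡⟨ cong (λ e → c + c ≤ (loops + loops) + e) arcs≡edges+edges ⟨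
    c + c ≤ (loops + loops) + arcs                       ≈⟨ sat-quantifier x (translate φ) σ (c + c) ⟨
    Sat 𝔊 (translate (exists≥ c x φ)) σ                  ∎
    where
    open ⇔-Reasoning
    open SubdivisionCount G (λ a b → sat? G (translate φ) (update₂ σ x a b))
                            (λ w a b enc → translate-correct φ (represents-update {σ = σ} rep enc))

-- Closing a formula

module Closure {m} (z : Fin m) where
  open Connectives z

  guard : {P : Set} → Dec P → Formula m → Formula m
  guard (yes _) α = α
  guard (no _)  _ = ⊥′

  ⊥′-closed : ∀ {v} → ¬ Free v ⊥′
  ⊥′-closed (v≢z , inj₁ v≡z) = v≢z v≡z
  ⊥′-closed (v≢z , inj₂ v≡z) = v≢z v≡z

  free-guard : ∀ {P} (P? : Dec P) α {v} → Free v (guard P? α) → P × Free v α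
  free-guard (yes p) α free = p , free
  free-guard (no _)  α free = ⊥-elim (⊥′-closed free)

  sat-guard : ∀ {P} (P? : Dec P) α 𝔄 ρ → (¬ P → ¬ Sat 𝔄 α ρ) → Sat 𝔄 (guard P? α) ρ ⇔ Sat 𝔄 α ρ
  sat-guard (yes _) α 𝔄 ρ _   = ⇔-refl
  sat-guard (no ¬p) α 𝔄 ρ ¬α = mk⇔ (⊥-elim ∘ sat-⊥′ 𝔄 ρ) (⊥-elim ∘ ¬α ¬p)

  -- An atom with an unassigned variable is false, so guarding the atoms by B is harmless
  -- as long as the variables outside B are unassigned.
  close : Subset m → Formula m → Formula m
  close B (edge i j)      = guard (i ∈ₛ? B ×-dec j ∈ₛ? B) (edge i j)
  close B (equal i j)     = guard (i ∈ₛ? B ×-dec j ∈ₛ? B) (equal i j)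
  close B (neg φ)         = neg (close B φ)
  close B (conj φ ψ)      = conj (close B φ) (close B ψ)
  close B (exists≥ c x φ) = exists≥ c x (close (B ∪ ⁅ x ⁆) φ)

  free-close : ∀ B φ {v} → Free v (close B φ) → v ∈ₛ B
  free-close B (edge i j)  free with free-guard (i ∈ₛ? B ×-dec j ∈ₛ? B) (edge i j) free
  ... | (i∈B , _) , inj₁ refl = i∈B
  ... | (_ , j∈B) , inj₂ refl = j∈B
  free-close B (equal i j) free with free-guard (i ∈ₛ? B ×-dec j ∈ₛ? B) (equal i j) free
  ... | (i∈B , _) , inj₁ refl = i∈B
  ... | (_ , j∈B) , inj₂ refl = j∈B
  free-close B (neg φ)          free        = free-close B φ free
  free-close B (conj φ ψ)       (inj₁ free) = free-close B φ free
  free-close B (conj φ ψ)       (inj₂ free) = free-close B ψ free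
  free-close B (exists≥ c x φ) (v≢x , free) with x∈p∪q⁻ B ⁅ x ⁆ (free-close (B ∪ ⁅ x ⁆) φ free)
  ... | inj₁ v∈B  = v∈B
  ... | inj₂ v∈⁅x⁆ = ⊥-elim (v≢x (x∈⁅y⁆⇒x≡y x v∈⁅x⁆))

  liftRel-undefined : ∀ {V : Set} {R : V → V → Set} B (ρ : Assignment m V) i j →
                      (∀ v → v ∉ₛ B → ρ v ≡ nothing) → ¬ (i ∈ₛ B × j ∈ₛ B) → ¬ liftRel R (ρ i) (ρ j)
  liftRel-undefined B ρ i j undefined ¬i,j∈B with i ∈ₛ? B
  ... | no  i∉B rewrite undefined i i∉B = λ ()
  ... | yes i∈B rewrite undefined j (¬i,j∈B ∘ (i∈B ,_)) with ρ i
  ...   | just _  = λ ()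
  ...   | nothing = λ ()

  sat-close : ∀ 𝔄 B φ ρ → (∀ v → v ∉ₛ B → ρ v ≡ nothing) → Sat 𝔄 (close B φ) ρ ⇔ Sat 𝔄 φ ρ
  sat-close 𝔄 B (edge i j) ρ undefined =
    sat-guard (i ∈ₛ? B ×-dec j ∈ₛ? B) (edge i j) 𝔄 ρ (liftRel-undefined B ρ i j undefined)
  sat-close 𝔄 B (equal i j) ρ undefined =
    sat-guard (i ∈ₛ? B ×-dec j ∈ₛ? B) (equal i j) 𝔄 ρ (liftRel-undefined B ρ i j undefined)
  sat-close 𝔄 B (neg φ)    ρ undefined = ¬-cong-⇔ (sat-close 𝔄 B φ ρ undefined)
  sat-close 𝔄 B (conj φ ψ) ρ undefined = sat-close 𝔄 B φ ρ undefined ×-⇔ sat-close 𝔄 B ψ ρ undefined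
  sat-close 𝔄 B (exists≥ c x φ) ρ undefined =
    AtLeast-cong (λ a → sat-close 𝔄 (B ∪ ⁅ x ⁆) φ (update ρ x a) (undefined′ a)) c
    where
    undefined′ : ∀ a v → v ∉ₛ B ∪ ⁅ x ⁆ → update ρ x a v ≡ nothing
    undefined′ a v v∉ = trans (update-other ρ a λ { refl → v∉ (x∈p∪q⁺ (inj₂ (x∈⁅x⁆ v))) })
                              (undefined v (v∉ ∘ x∈p∪q⁺ ∘ inj₁))

  closure : Formula m → Formula m
  closure = close ∅

  closure-sentence : ∀ φ → Sentence (closure φ)
  closure-sentence φ v free = ∉⊥ (free-close ∅ φ free)

  closure-⊨ : ∀ 𝔄 φ → 𝔄 ⊨ closure φ ⇔ 𝔄 ⊨ φ
  closure-⊨ 𝔄 φ = sat-close 𝔄 ∅ φ (λ _ → nothing) (λ _ _ → refl)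

-- Fin (2 * k) is Fin (k + (k + 0)).
left right : ∀ {k} → Fin k → Fin (2 * k)
left  {k} i = i ↑ˡ (k + 0)
right {k} i = k ↑ʳ (i ↑ˡ 0)

left-injective : ∀ {k} → Injective _≡_ _≡_ (left {k})
left-injective {k} = Fin.↑ˡ-injective (k + 0) _ _

right-injective : ∀ {k} → Injective _≡_ _≡_ (right {k})
right-injective {k} = Fin.↑ˡ-injective 0 _ _ ∘ Fin.↑ʳ-injective k _ _

left≢right : ∀ {k} (i j : Fin k) → left i ≢ right j
left≢right {k} i j eq with inj₁≡inj₂
  where
  open ≡-Reasoning
  inj₁≡inj₂ : inj₁ i ≡ inj₂ (j ↑ˡ 0)
  inj₁≡inj₂ = begin
    inj₁ i                   ≡⟨ Fin.splitAt-↑ˡ k i (k + 0) ⟨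
    Fin.splitAt k (left i)   ≡⟨ cong (Fin.splitAt k) eq ⟩
    Fin.splitAt k (right j)  ≡⟨ Fin.splitAt-↑ʳ k (k + 0) (j ↑ˡ 0) ⟩
    inj₂ (j ↑ˡ 0)            ∎
... | ()

-- k ≥ 1 supplies the variable left zero from which ⊤′ is built.
module _ {k : ℕ} where
  open Translation (left {suc k}) right (left zero)
  open Closure (left {suc k} zero)

  translation : Formula (suc k) → Formula (2 * suc k)
  translation φ = closure (translate φ)

  translation-sentence : ∀ φ → Sentence (translation φ)
  translation-sentence φ = closure-sentence (translate φ)

  subdivide-⊨⇔ : ∀ {n} (G : Graph n) φ → subdivide G ⊨ φ ⇔ toStr G ⊨ translation φ
  subdivide-⊨⇔ G φ = ⇔-trans (translate-correct φ (λ _ → refl , refl)) (⇔-sym (closure-⊨ (toStr G) (translate φ)))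
    where open Correspondence G (left {suc k}) right left-injective right-injective left≢right (left zero)

lemma3p3 : (k : ℕ) → 1 ≤ k → {n m : ℕ} (G : Graph n) (H : Graph m) →
    C-equiv (2 * k) (toStr G) (toStr H) →
    C-equiv k (subdivide G) (subdivide H)
lemma3p3 (suc k) _ G H G≡H φ _ = Equivalence.to G¹⇔H¹ , Equivalence.from G¹⇔H¹
  where
  open ⇔-Reasoning
  G¹⇔H¹ : subdivide G ⊨ φ ⇔ subdivide H ⊨ φ
  G¹⇔H¹ = begin
    subdivide G ⊨ φ          ≈⟨ subdivide-⊨⇔ G φ ⟩
    toStr G ⊨ translation φ  ≈⟨ G⇔H ⟩
    toStr H ⊨ translation φ  ≈⟨ subdivide-⊨⇔ H φ ⟨
    subdivide H ⊨ φ          ∎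
    where
    G⇔H : toStr G ⊨ translation φ ⇔ toStr H ⊨ translation φ
    G⇔H = let (to , from) = G≡H (translation φ) (translation-sentence φ) in mk⇔ to from
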